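{- Let $\mathcal{G}=\langle V,E,w\rangle$ be a mean-payoff bidding game whose graph is strongly connected (not necessarily recurrent), and let $u\in V$. Then $W(u)=\sum_{v\in V}cont(v)\cdot w(v)$.
   Context: $\mathcal{G}=\langle V,E,w\rangle$ is a finite directed graph with weights $w:V\to\mathbb{Z}$. Weighted Richman function: form $\mathcal{G}^u$ by replacing $u$ with two copies $u_s$ (having the outgoing edges of $u$ and no incoming edges) and $u_t$ (having the incoming edges of $u$ and no outgoing edges), both with weight $w(u)$. Define $W$ on $\mathcal{G}^u$ by $W(u_t)=0$ and, for every other vertex $v$, $W(v)=\frac12\big(W(v^+)+W(v^-)\big)+w(v)$, where $v^+$ and $v^-$ are successors of $v$ maximizing and minimizing $W$, respectively; $W(u)$ is defined as $W(u_s)$. Contribution: $cont(u_s)=1$, and for a vertex $v$, with $pre(v)=\{v' : v=v'^- \text{ or } v=v'^+\}$, $cont(v)=\sum_{v'\in pre(v)}\frac12\,cont(v')$. A strongly connected graph is recurrent if some vertex lies on every cycle. -}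

module Defs where

open import Data.Nat using (ℕ; zero; suc)
open import Data.Fin using (Fin; zero; suc)
open import Data.Bool using (Bool; true; false; T; if_then_else_)
open import Data.Integer using (ℤ)
open import Data.Empty using (⊥)
open import Data.Rational using (ℚ; 0ℚ; 1ℚ; ½; _+_; _*_; _≤_; _/_)
open import Data.Product using (_×_; Σ; _,_)
open import Relation.Nullary using (¬_; does)
open import Relation.Binary.PropositionalEquality using (_≡_)
open import Relation.Binary.Construct.Closure.ReflexiveTransitive using (Star)
import Data.Fin.Properties as FinP

record WGraph (n : ℕ) : Set where
  field
    E : Fin n → Fin n → Bool
    w : Fin n → ℤ

open WGraph public

Edge : ∀ {n} → WGraph n → Fin n → Fin n → Set
Edge G x y = T (E G x y)

StronglyConnected : ∀ {n} → WGraph n → Set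
StronglyConnected {n} G = (x y : Fin n) → Star (Edge G) x y

-- Vertices of G^u : an old vertex  old x  (where  old u  plays the role of u_s)
-- and the new sink  tgt  (= u_t).
data VertU (n : ℕ) : Set where
  old : Fin n → VertU n
  tgt : VertU n

-- Edges of G^u (u fixed):
--   old x → old y  iff  x → y in G and y ≠ u   (u_s gets u's outgoing edges,
--                                                 no edges enter u_s)
--   old x → tgt    iff  x → u in G              (u_t gets u's incoming edges)
--   tgt has no outgoing edges.
EdgeU : ∀ {n} → WGraph n → Fin n → VertU n → VertU n → Set
EdgeU G u (old x) (old y) = Edge G x y × ¬ (y ≡ u)
EdgeU G u (old x) tgt     = Edge G x u
EdgeU G u tgt     _       = ⊥

_==_ : ∀ {n} → VertU n → VertU n → Bool
old x == old y = does (x FinP.≟ y)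
old x == tgt   = false
tgt   == old y = false
tgt   == tgt   = true

Σℚ : ∀ {n} → (Fin n → ℚ) → ℚ
Σℚ {zero}  f = 0ℚ
Σℚ {suc n} f = f zero + Σℚ (λ i → f (suc i))

toℚ : ℤ → ℚ
toℚ z = z / 1

-- Weighted Richman function data on G^u: W together with the successor
-- choices v⁺ (plus) and v⁻ (minus) for every vertex other than u_t
-- (i.e. for every old x; old u is u_s).
record IsRichman {n} (G : WGraph n) (u : Fin n)
                 (W : VertU n → ℚ) (plus minus : Fin n → VertU n) : Set where
  field
    W-tgt      : W tgt ≡ 0ℚ
    plus-edge  : ∀ x → EdgeU G u (old x) (plus x)
    minus-edge : ∀ x → EdgeU G u (old x) (minus x)
    plus-max   : ∀ x y → EdgeU G u (old x) y → W y ≤ W (plus x)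
    minus-min  : ∀ x y → EdgeU G u (old x) y → W (minus x) ≤ W y
    W-eq       : ∀ x → W (old x) ≡ ½ * (W (plus x) + W (minus x)) + toℚ (w G x)

-- Contribution: cont(u_s) = 1 and, for v ≠ u_s,
--   cont(v) = Σ_{v'} ( ½·[v = v'⁺] + ½·[v = v'⁻] ) · cont(v')
-- (a predecessor v' with v'⁺ = v'⁻ = v contributes twice, i.e. cont(v')).
-- Only old vertices have successors, so v' ranges over old x.
preSum : ∀ {n} → (plus minus : Fin n → VertU n) → (cont : VertU n → ℚ) → VertU n → ℚ
preSum plus minus cont v =
  Σℚ (λ x → (if plus x == v then ½ * cont (old x) else 0ℚ)
          + (if minus x == v then ½ * cont (old x) else 0ℚ))

record IsCont {n} (u : Fin n) (plus minus : Fin n → VertU n)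
              (cont : VertU n → ℚ) : Set where
  field
    cont-src : cont (old u) ≡ 1ℚ
    cont-eq  : ∀ v → ¬ (v ≡ old u) → cont v ≡ preSum plus minus cont v

module Submission where

-- Idea of the proof (double counting).  Write c(x) = cont(x) for the vertices
-- x of G (so x = u stands for u_s) and evaluate  S = Σ_x W(x)·c(x)  in two ways.
--
--  * Unfolding W by its defining equation  W(x) = ½(W(x⁺) + W(x⁻)) + w(x)  gives
--      S = Σ_x ½c(x)·(W(x⁺) + W(x⁻)) + Σ_x c(x)·w(x).
--  * Unfolding c by its defining equation  c(y) = pre(y)  (for y ≠ u_s), using
--    c(u_s) = 1 and pre(u_s) = 0 (no edge of G^u enters u_s), gives
--      S = Σ_y W(y)·pre(y) + W(u_s).
--
-- Exchanging the order of summation in Σ_y W(y)·pre(y) and collapsing the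
-- indicator sums shows  Σ_y W(y)·pre(y) = Σ_x ½c(x)·(W(x⁺) + W(x⁻)); the one
-- successor that is not an old vertex, u_t, contributes nothing as W(u_t) = 0.
-- Cancelling this common term yields  W(u_s) = Σ_x c(x)·w(x).

open import Defs
open import Data.Nat using (zero; suc)
open import Data.Fin using (Fin; zero; suc)
open import Data.Bool using (false; if_then_else_)
open import Data.Empty using (⊥-elim)
open import Data.Product using (_,_)
open import Data.Rational using (ℚ; _*_; _+_; 0ℚ; 1ℚ; ½)
open import Data.Rational.Properties
  using (+-*-ring; +-0-group; +-identityˡ; +-identityʳ; *-zeroˡ; *-zeroʳ; *-identityʳ; *-distribˡ-+)
open import Algebra.Bundles using (Ring)
open import Algebra.Properties.Semiring.Sum (Ring.semiring +-*-ring)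
  using (sum; sum-cong-≗; sum-replicate-zero; ∑-distrib-+; ∑-comm; *-distribˡ-sum)
open import Algebra.Properties.Group +-0-group using (∙-cancelˡ)
open import Relation.Nullary using (yes; no; does)
open import Relation.Binary.PropositionalEquality using (_≡_; refl; sym; trans; cong; cong₂; module ≡-Reasoning)
import Data.Fin.Properties as FinP
open import Data.Rational.Solver using (module +-*-Solver)
open +-*-Solver using (solve; con; _:+_; _:*_; _:=_)

Σℚ≡sum : ∀ {n} (f : Fin n → ℚ) → Σℚ f ≡ sum f
Σℚ≡sum {zero}  f = refl
Σℚ≡sum {suc n} f = cong (f zero +_) (Σℚ≡sum (λ i → f (suc i)))

sum-zero : ∀ {n} (f : Fin n → ℚ) → (∀ i → f i ≡ 0ℚ) → sum f ≡ 0ℚ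
sum-zero {n} f f≡0 = trans (sum-cong-≗ f≡0) (sum-replicate-zero n)

sum-δ : ∀ {n} (x : Fin n) (f : Fin n → ℚ) (c : ℚ) →
        sum (λ y → f y * (if does (x FinP.≟ y) then c else 0ℚ)) ≡ f x * c
sum-δ {suc n} zero f c = begin
    f zero * c + sum (λ y → f (suc y) * 0ℚ)
  ≡⟨ cong (f zero * c +_) (sum-zero _ (λ y → *-zeroʳ (f (suc y)))) ⟩
    f zero * c + 0ℚ
  ≡⟨ +-identityʳ _ ⟩
    f zero * c ∎
  where open ≡-Reasoning
sum-δ {suc n} (suc x) f c = begin
    f zero * 0ℚ + sum (λ y → f (suc y) * (if does (x FinP.≟ y) then c else 0ℚ))
  ≡⟨ cong₂ _+_ (*-zeroʳ (f zero)) (sum-δ x (λ y → f (suc y)) c) ⟩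
    0ℚ + f (suc x) * c
  ≡⟨ +-identityˡ _ ⟩
    f (suc x) * c ∎
  where open ≡-Reasoning

-- δ-lemma on the vertices of G^u, summing over the old vertices only: the
-- sink u_t is never selected, which is harmless for functions vanishing at it.
sum-δ-old : ∀ {n} (g : VertU n → ℚ) → g tgt ≡ 0ℚ → (p : VertU n) (c : ℚ) →
            sum (λ y → g (old y) * (if p == old y then c else 0ℚ)) ≡ g p * c
sum-δ-old g g-tgt (old x) c = sum-δ x (λ y → g (old y)) c
sum-δ-old g g-tgt tgt     c = begin
    sum (λ y → g (old y) * 0ℚ)  ≡⟨ sum-zero _ (λ y → *-zeroʳ (g (old y))) ⟩
    0ℚ                          ≡⟨ sym (*-zeroˡ c) ⟩
    0ℚ * c                      ≡⟨ cong (_* c) (sym g-tgt) ⟩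
    g tgt * c                   ∎
  where open ≡-Reasoning

sum-preSum : ∀ {n} (plus minus : Fin n → VertU n) (cont : VertU n → ℚ)
             (g : VertU n → ℚ) → g tgt ≡ 0ℚ →
             sum (λ y → g (old y) * preSum plus minus cont (old y))
             ≡ sum (λ x → g (plus x) * (½ * cont (old x)) + g (minus x) * (½ * cont (old x)))
sum-preSum {n} plus minus cont g g-tgt = begin
    sum (λ y → g (old y) * preSum plus minus cont (old y))
  ≡⟨ sum-cong-≗ (λ y → cong (g (old y) *_) (Σℚ≡sum (share y))) ⟩
    sum (λ y → g (old y) * sum (share y))
  ≡⟨ sum-cong-≗ (λ y → *-distribˡ-sum (g (old y)) (share y)) ⟩
    sum (λ y → sum (λ x → g (old y) * share y x))
  ≡⟨ ∑-comm (λ y x → g (old y) * share y x) ⟩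
    sum (λ x → sum (λ y → g (old y) * share y x))
  ≡⟨ sum-cong-≗ (λ x → trans (sum-cong-≗ (λ y → *-distribˡ-+ (g (old y)) (viaPlus x y) (viaMinus x y)))
                             (∑-distrib-+ (λ y → g (old y) * viaPlus x y) (λ y → g (old y) * viaMinus x y))) ⟩
    sum (λ x → sum (λ y → g (old y) * viaPlus x y) + sum (λ y → g (old y) * viaMinus x y))
  ≡⟨ sum-cong-≗ (λ x → cong₂ _+_ (sum-δ-old g g-tgt (plus x) (half x))
                                 (sum-δ-old g g-tgt (minus x) (half x))) ⟩
    sum (λ x → g (plus x) * half x + g (minus x) * half x) ∎
  where
  open ≡-Reasoning
  half : Fin n → ℚ
  half x = ½ * cont (old x)
  viaPlus viaMinus : Fin n → Fin n → ℚ
  viaPlus  x y = if plus x  == old y then half x else 0ℚ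
  viaMinus x y = if minus x == old y then half x else 0ℚ
  share : Fin n → Fin n → ℚ
  share y x = viaPlus x y + viaMinus x y

no-edge-into-source : ∀ {n} (G : WGraph n) (u x : Fin n) (p : VertU n) →
                      EdgeU G u (old x) p → (p == old u) ≡ false
no-edge-into-source G u x (old y) (_ , y≢u) with y FinP.≟ u
... | yes y≡u = ⊥-elim (y≢u y≡u)
... | no  _   = refl
no-edge-into-source G u x tgt _ = refl

preSum-source : ∀ {n} (G : WGraph n) (u : Fin n) (plus minus : Fin n → VertU n) →
                (∀ x → EdgeU G u (old x) (plus x)) → (∀ x → EdgeU G u (old x) (minus x)) →
                (cont : VertU n → ℚ) → preSum plus minus cont (old u) ≡ 0ℚ
preSum-source {n} G u plus minus plus-edge minus-edge cont =
  trans (Σℚ≡sum share) (sum-zero share no-share)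
  where
  share : Fin n → ℚ
  share x = (if plus x == old u then ½ * cont (old x) else 0ℚ)
          + (if minus x == old u then ½ * cont (old x) else 0ℚ)
  no-share : ∀ x → share x ≡ 0ℚ
  no-share x rewrite no-edge-into-source G u x (plus x) (plus-edge x)
                   | no-edge-into-source G u x (minus x) (minus-edge x) = +-identityʳ 0ℚ

module Expansions {n} (G : WGraph n) (u : Fin n)
    (W : VertU n → ℚ) (plus minus : Fin n → VertU n) (R : IsRichman G u W plus minus)
    (cont : VertU n → ℚ) (C : IsCont u plus minus cont) where
  open IsRichman R
  open IsCont C

  pre : Fin n → ℚ
  pre y = preSum plus minus cont (old y)

  passed : Fin n → ℚ
  passed x = W (plus x) * (½ * cont (old x)) + W (minus x) * (½ * cont (old x))

  weighted : Fin n → ℚ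
  weighted x = cont (old x) * toℚ (w G x)

  expand-cont : sum (λ y → W (old y) * cont (old y)) ≡ sum (λ y → W (old y) * pre y) + W (old u)
  expand-cont = begin
      sum (λ y → W (old y) * cont (old y))
    ≡⟨ sum-cong-≗ split ⟩
      sum (λ y → W (old y) * pre y + W (old y) * (if does (u FinP.≟ y) then 1ℚ else 0ℚ))
    ≡⟨ ∑-distrib-+ (λ y → W (old y) * pre y) (λ y → W (old y) * (if does (u FinP.≟ y) then 1ℚ else 0ℚ)) ⟩
      sum (λ y → W (old y) * pre y) + sum (λ y → W (old y) * (if does (u FinP.≟ y) then 1ℚ else 0ℚ))
    ≡⟨ cong (sum (λ y → W (old y) * pre y) +_) (trans (sum-δ u (λ y → W (old y)) 1ℚ) (*-identityʳ _)) ⟩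
      sum (λ y → W (old y) * pre y) + W (old u) ∎
    where
    open ≡-Reasoning
    -- cont(y) = pre(y) + [y = u_s], since cont(u_s) = 1 and pre(u_s) = 0
    split : ∀ y → W (old y) * cont (old y)
                ≡ W (old y) * pre y + W (old y) * (if does (u FinP.≟ y) then 1ℚ else 0ℚ)
    split y with u FinP.≟ y
    ... | yes refl rewrite cont-src | preSum-source G u plus minus plus-edge minus-edge cont =
      solve 1 (λ a → a :* con 1ℚ := a :* con 0ℚ :+ a :* con 1ℚ) refl (W (old u))
    ... | no u≢y rewrite cont-eq (old y) (λ { refl → u≢y refl }) =
      sym (trans (cong (W (old y) * pre y +_) (*-zeroʳ (W (old y)))) (+-identityʳ _))

  expand-W : sum (λ y → W (old y) * cont (old y)) ≡ sum passed + sum weighted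
  expand-W = trans (sum-cong-≗ unfold) (∑-distrib-+ passed weighted)
    where
    unfold : ∀ x → W (old x) * cont (old x) ≡ passed x + weighted x
    unfold x = trans (cong (_* cont (old x)) (W-eq x))
      (solve 5 (λ h a b c k → (h :* (a :+ b) :+ k) :* c := (a :* (h :* c) :+ b :* (h :* c)) :+ c :* k)
        refl ½ (W (plus x)) (W (minus x)) (cont (old x)) (toℚ (w G x)))

lemma24 : ∀ {n} (G : WGraph n) → StronglyConnected G → (u : Fin n) →
          (W : VertU n → ℚ) (plus minus : Fin n → VertU n) →
          IsRichman G u W plus minus →
          (cont : VertU n → ℚ) → IsCont u plus minus cont →
          W (old u) ≡ Σℚ (λ v → cont (old v) * toℚ (w G v))
lemma24 G _ u W plus minus R cont C =
  trans (∙-cancelˡ (sum passed) (W (old u)) (sum weighted) both-expansions)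
        (sym (Σℚ≡sum weighted))
  where
  open Expansions G u W plus minus R cont C
  both-expansions : sum passed + W (old u) ≡ sum passed + sum weighted
  both-expansions = begin
      sum passed + W (old u)                      ≡⟨ cong (_+ W (old u)) exchange ⟨
      sum (λ y → W (old y) * pre y) + W (old u)   ≡⟨ expand-cont ⟨
      sum (λ y → W (old y) * cont (old y))        ≡⟨ expand-W ⟩
      sum passed + sum weighted                   ∎
    where
    open ≡-Reasoning
    exchange : sum (λ y → W (old y) * pre y) ≡ sum passed
    exchange = sum-preSum plus minus cont W (IsRichman.W-tgt R)
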